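{- Let $n\ge 1$, $r\ge 0$, $m\ge 1$. Suppose $a\in H_{m-1}(VR(Q_n;r);\mathbb{Z})$ is a non-trivial homology class represented by a cycle $\alpha$ which is the boundary of a cross polytope on $2m$ vertices, i.e. $\alpha$ is the fundamental cycle of a subcomplex of $VR(Q_n;r)$ of the form $\{v_1,w_1\}*\{v_2,w_2\}*\cdots*\{v_m,w_m\}$ (a join of $m$ two-point complexes) on $2m$ distinct vertices, where for each $i$ the pair $\{v_i,w_i\}$ is not an edge of $VR(Q_n;r)$. Then the vertex set $\{v_1,w_1,\ldots,v_m,w_m\}$ of $\alpha$ is a total dominating set of the graph $G_{n,r}^c$.
   Context: $Q_n=\{0,1\}^n$ with the Hamming distance $d_H$. $VR(Q_n;r)$ is the simplicial complex on vertex set $Q_n$ whose simplices are the subsets of $d_H$-diameter at most $r$. $G_{n,r}^c$ is the simple graph on $Q_n$ in which distinct $a,b$ are adjacent iff $d_H(a,b)>r$. For a graph $G$ without isolated vertices, a total dominating set is a subset $S\subseteq V(G)$ such that every vertex of $G$ (including those in $S$) is adjacent to at least one vertex of $S$; a vertex does not dominate itself. -}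

module Defs where

open import Data.Bool using (Bool; true; false; if_then_else_; _∧_; _∨_; not)
open import Data.Nat using (ℕ; zero; suc; _+_; _*_; _≤_; _<_; _<ᵇ_)
open import Data.Integer using (ℤ; -_; 0ℤ; 1ℤ) renaming (_+_ to _+ℤ_; _*_ to _*ℤ_)
open import Data.Fin using (Fin; toℕ)
open import Data.List using (List; []; _∷_; foldr; map; concatMap; allFin)
open import Data.Vec using (Vec; []; _∷_; lookup; tabulate; insertAt)
open import Data.Product using (Σ; ∃; _×_; _,_)
open import Data.Sum using (_⊎_)
open import Relation.Binary.PropositionalEquality using (_≡_; _≢_)

Vertex : ℕ → Set
Vertex n = Vec Bool n

dH : ∀ {n} → Vertex n → Vertex n → ℕ
dH [] [] = 0
dH (x ∷ xs) (y ∷ ys) = (if x Data.Bool.xor y then 1 else 0) + dH xs ys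

allVertices : ∀ n → List (Vertex n)
allVertices zero = [] ∷ []
allVertices (suc n) = concatMap (λ xs → (false ∷ xs) ∷ (true ∷ xs) ∷ []) (allVertices n)

-- A fixed total order on Q_n (via binary value), used to orient simplices
val : ∀ {n} → Vertex n → ℕ
val [] = 0
val (x ∷ xs) = (if x then 1 else 0) + 2 * val xs

eqV : ∀ {n} → Vertex n → Vertex n → Bool
eqV [] [] = true
eqV (x ∷ xs) (y ∷ ys) = not (x Data.Bool.xor y) ∧ eqV xs ys

sumℤ : List ℤ → ℤ
sumℤ = foldr _+ℤ_ 0ℤ

sgn : ℕ → ℤ
sgn zero = 1ℤ
sgn (suc k) = - sgn k

-- A chain on ℓ vertices (dimension ℓ-1) is a function on ℓ-tuples of
-- vertices; the basis element for a simplex {x₀<…<x_{ℓ-1}} (w.r.t. val)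
-- is the strictly increasing tuple. Chains of VR(Q_n;r) are required to
-- vanish outside such tuples that are simplices of VR(Q_n;r).

Chain : ℕ → ℕ → Set
Chain n ℓ = Vec (Vertex n) ℓ → ℤ

StrictlyIncreasing : ∀ {n ℓ} → Vec (Vertex n) ℓ → Set
StrictlyIncreasing {ℓ = ℓ} σ = ∀ (i j : Fin ℓ) → toℕ i < toℕ j → val (lookup σ i) < val (lookup σ j)

IsVRSimplex : ∀ {n ℓ} → ℕ → Vec (Vertex n) ℓ → Set
IsVRSimplex {ℓ = ℓ} r σ = StrictlyIncreasing σ × (∀ (i j : Fin ℓ) → dH (lookup σ i) (lookup σ j) ≤ r)

IsVRChain : ∀ {n ℓ} → ℕ → Chain n ℓ → Set
IsVRChain r c = ∀ σ → c σ ≢ 0ℤ → IsVRSimplex r σ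

∂ : ∀ {n ℓ} → Chain n (suc ℓ) → Chain n ℓ
∂ {n} {ℓ} c τ = sumℤ (map (λ i → sumℤ (map (λ x → sgn (toℕ i) *ℤ c (insertAt τ i x)) (allVertices n))) (allFin (suc ℓ)))

increasingB : ∀ {n ℓ} → Vec (Vertex n) ℓ → Bool
increasingB [] = true
increasingB (x ∷ []) = true
increasingB (x ∷ y ∷ ys) = (val x <ᵇ val y) ∧ increasingB (y ∷ ys)

memB : ∀ {n ℓ} → Vertex n → Vec (Vertex n) ℓ → Bool
memB x [] = false
memB x (y ∷ ys) = eqV x y ∨ memB x ys

allB : ∀ {A : Set} {ℓ} → (A → Bool) → Vec A ℓ → Bool
allB p [] = true
allB p (x ∷ xs) = p x ∧ allB p xs

countB : ∀ {A : Set} {ℓ} → (A → Bool) → Vec A ℓ → ℕ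
countB p [] = 0
countB p (x ∷ xs) = (if p x then 1 else 0) + countB p xs

inversions : ∀ {n ℓ} → Vec (Vertex n) ℓ → ℕ
inversions [] = 0
inversions (x ∷ xs) = countB (λ y → val y <ᵇ val x) xs + inversions xs

-- the elementary chain of the oriented simplex [u₀,…,u_{ℓ-1}] (u with distinct entries):
-- value (-1)^{inv u} on the increasing rearrangement of u, 0 elsewhere
oriented : ∀ {n ℓ} → Vec (Vertex n) ℓ → Chain n ℓ
oriented u τ = if increasingB τ ∧ allB (λ x → memB x τ) u then sgn (inversions u) else 0ℤ

allBoolVecs : ∀ m → List (Vec Bool m)
allBoolVecs = allVertices

-- fundamental cycle of the cross-polytope boundary {v₁,w₁} * … * {v_m,w_m}:
-- Σ_ε (-1)^{#\{i : ε_i = w\}} [u₁^ε, …, u_m^ε]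
crossCycle : ∀ {n m} → (Fin m → Vertex n) → (Fin m → Vertex n) → Chain n m
crossCycle {n} {m} v w τ =
  sumℤ (map (λ ε → sgn (countB (λ b → b) ε) *ℤ
                    oriented (tabulate (λ i → if lookup ε i then w i else v i)) τ)
            (allBoolVecs m))

AdjGc : ∀ {n} → ℕ → Vertex n → Vertex n → Set
AdjGc r a b = a ≢ b × r < dH a b

TotalDominatingGc : ∀ n → ℕ → (Vertex n → Set) → Set
TotalDominatingGc n r S = ∀ (x : Vertex n) → ∃ λ s → S s × AdjGc r x s

-- Suppose some vertex x were adjacent in G^c to none of the v_i, w_i.  Then x differs from all of
-- them (x = v_i would make x adjacent to w_i, as d(v_i, w_i) > r) and lies within distance r of each,
-- so the cone x * α is a chain of VR(Q_n; r).  Its boundary is α - x * ∂α = α, since ∂α = 0: each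
-- face of a facet of the cross-polytope lies in exactly two facets, which differ in one choice
-- v_j / w_j and carry opposite signs.  So α would bound.  Chains are functions on sorted tuples and
-- the oriented simplex [u] carries the sign of the permutation sorting u, so the boundary formula
-- ∂[u] = Σ_j (-1)^j [u without u_j] comes down to counting inversions.

module Submission where

open import Defs
open import Data.Bool using (Bool; true; false; if_then_else_; _∧_; not)
open import Data.Bool.Properties
  using (∧-conicalˡ; ∧-conicalʳ; ∧-zeroʳ; ∧-identityʳ; ∨-zeroʳ; ¬-not; xor-same; xor-comm; T-≡)
  renaming (_≟_ to _≟ᵇ_)
open import Data.Fin using (Fin; zero; suc; toℕ; punchIn; punchOut) renaming (_≟_ to _≟ᶠ_)
open import Data.Fin.Properties using (any?; punchIn-injective; punchInᵢ≢i; punchIn-punchOut; suc-injective; 0≢1+n)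
open import Data.Integer using (ℤ; -_; 0ℤ; 1ℤ; -1ℤ) renaming (_+_ to _+ℤ_; _*_ to _*ℤ_)
import Data.Integer.Properties as ℤ
import Data.Integer.Tactic.RingSolver as ℤ-Solver
open import Data.List using (List; []; _∷_; map; allFin; concatMap)
import Data.List as List
open import Data.Nat using (ℕ; zero; suc; pred; _+_; _≤_; _<_; _<ᵇ_; z≤n; s≤s)
open import Data.Nat.Properties using (<-cmp; <-trans; <-asym; <ᵇ⇒<; <⇒<ᵇ; ≮⇒≥; _<?_; even≢odd; *-cancelˡ-≡)
import Data.Nat.Tactic.RingSolver as ℕ-Solver
open import Data.Product using (∃; _×_; _,_; proj₁; proj₂)
open import Data.Sum using (_⊎_; inj₁; inj₂)
open import Data.Vec using (Vec; []; _∷_; tail; lookup; insertAt; removeAt; updateAt; tabulate)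
open import Data.Vec.Properties
  using (insertAt-lookup; insertAt-punchIn; removeAt-punchOut; lookup∘tabulate; tabulate-cong; lookup∘updateAt′; ≡-dec)
open import Function using (_∘_; case_of_; Equivalence)
open import Relation.Binary using (tri<; tri≈; tri>)
open import Relation.Binary.PropositionalEquality
  using (_≡_; _≢_; refl; sym; trans; cong; cong₂; subst; subst₂; module ≡-Reasoning)
open import Relation.Nullary using (¬_; Dec; yes; no; contradiction)
open import Relation.Nullary.Decidable using (¬?; _×-dec_; _⊎-dec_)

open import Algebra.Properties.CommutativeMonoid.Sum ℤ.+-0-commutativeMonoid
  using (sum; sum-cong-≗; sum-remove; sum-replicate-zero)

∧≡true : ∀ {a b} → (a ∧ b) ≡ true → a ≡ true × b ≡ true
∧≡true {a} {b} e = ∧-conicalˡ a b e , ∧-conicalʳ a b e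

∧-falseʳ : ∀ a {b} → b ≡ false → (a ∧ b) ≡ false
∧-falseʳ a refl = ∧-zeroʳ a

<⇒<ᵇ≡true : ∀ {a b} → a < b → (a <ᵇ b) ≡ true
<⇒<ᵇ≡true a<b = Equivalence.to T-≡ (<⇒<ᵇ a<b)

<ᵇ≡true⇒< : ∀ {a b} → (a <ᵇ b) ≡ true → a < b
<ᵇ≡true⇒< {a} {b} e = <ᵇ⇒< a b (Equivalence.from T-≡ e)

>⇒<ᵇ≡false : ∀ {a b} → b < a → (a <ᵇ b) ≡ false
>⇒<ᵇ≡false b<a = ¬-not (λ e → <-asym b<a (<ᵇ≡true⇒< e))

eqV-refl : ∀ {n} (x : Vertex n) → eqV x x ≡ true
eqV-refl [] = refl
eqV-refl (b ∷ xs) rewrite xor-same b = eqV-refl xs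

eqV⇒≡ : ∀ {n} (x y : Vertex n) → eqV x y ≡ true → x ≡ y
eqV⇒≡ [] [] _ = refl
eqV⇒≡ (false ∷ xs) (false ∷ ys) e = cong (false ∷_) (eqV⇒≡ xs ys e)
eqV⇒≡ (true ∷ xs) (true ∷ ys) e = cong (true ∷_) (eqV⇒≡ xs ys e)

val-injective : ∀ {n} (x y : Vertex n) → val x ≡ val y → x ≡ y
val-injective [] [] _ = refl
val-injective (false ∷ xs) (false ∷ ys) e = cong (false ∷_) (val-injective xs ys (*-cancelˡ-≡ _ _ 2 e))
val-injective (true ∷ xs) (true ∷ ys) e = cong (true ∷_) (val-injective xs ys (*-cancelˡ-≡ _ _ 2 (cong pred e)))
val-injective (false ∷ xs) (true ∷ ys) e = contradiction e (even≢odd (val xs) (val ys))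
val-injective (true ∷ xs) (false ∷ ys) e = contradiction (sym e) (even≢odd (val ys) (val xs))

dH-refl : ∀ {n} (x : Vertex n) → dH x x ≡ 0
dH-refl [] = refl
dH-refl (b ∷ xs) rewrite xor-same b = dH-refl xs

dH-sym : ∀ {n} (x y : Vertex n) → dH x y ≡ dH y x
dH-sym [] [] = refl
dH-sym (a ∷ xs) (b ∷ ys) rewrite xor-comm a b = cong (_ +_) (dH-sym xs ys)

_≟ᵛ_ : ∀ {n} (x y : Vertex n) → Dec (x ≡ y)
_≟ᵛ_ = ≡-dec _≟ᵇ_

Distinct : ∀ {A : Set} {ℓ} → Vec A ℓ → Set
Distinct u = ∀ i j → lookup u i ≡ lookup u j → i ≡ j

distinct-tail : ∀ {A : Set} {ℓ} {a : A} {u : Vec A ℓ} → Distinct (a ∷ u) → Distinct u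
distinct-tail d i j e = suc-injective (d (suc i) (suc j) e)

head∉tail : ∀ {A : Set} {ℓ} {a : A} {u : Vec A ℓ} → Distinct (a ∷ u) → ∀ k → lookup u k ≢ a
head∉tail d k e = 0≢1+n (d zero (suc k) (sym e))

lookup-removeAt : ∀ {A : Set} {ℓ} (u : Vec A (suc ℓ)) j k → lookup (removeAt u j) k ≡ lookup u (punchIn j k)
lookup-removeAt (x ∷ xs) zero k = refl
lookup-removeAt (x ∷ y ∷ ys) (suc j) zero = refl
lookup-removeAt (x ∷ y ∷ ys) (suc j) (suc k) = lookup-removeAt (y ∷ ys) j k

distinct-removeAt : ∀ {A : Set} {ℓ} (u : Vec A (suc ℓ)) j → Distinct u → Distinct (removeAt u j)
distinct-removeAt u j d k k′ e =
  punchIn-injective j k k′ (d _ _ (trans (sym (lookup-removeAt u j k)) (trans e (lookup-removeAt u j k′))))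

lookup-insertAt : ∀ {A : Set} {ℓ} (τ : Vec A ℓ) i (y : A) k →
  lookup (insertAt τ i y) k ≡ y ⊎ ∃ λ k′ → lookup (insertAt τ i y) k ≡ lookup τ k′
lookup-insertAt τ i y k with i ≟ᶠ k
... | yes refl = inj₁ (insertAt-lookup τ i y)
... | no i≢k = inj₂ (punchOut i≢k ,
  trans (cong (lookup (insertAt τ i y)) (sym (punchIn-punchOut i≢k))) (insertAt-punchIn τ i y (punchOut i≢k)))

memB⇒lookup : ∀ {n ℓ} {z : Vertex n} (τ : Vec (Vertex n) ℓ) → memB z τ ≡ true → ∃ λ k → lookup τ k ≡ z
memB⇒lookup {z = z} (y ∷ ys) e with eqV z y in eq
... | true = zero , sym (eqV⇒≡ z y eq)
... | false with memB⇒lookup ys e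
... | k , p = suc k , p

lookup⇒memB : ∀ {n ℓ} (τ : Vec (Vertex n) ℓ) k {z} → lookup τ k ≡ z → memB z τ ≡ true
lookup⇒memB (y ∷ ys) zero refl rewrite eqV-refl y = refl
lookup⇒memB (y ∷ ys) (suc k) refl rewrite lookup⇒memB ys k refl = ∨-zeroʳ _

∉⇒memB≡false : ∀ {n ℓ} {z : Vertex n} (τ : Vec (Vertex n) ℓ) → (∀ k → lookup τ k ≢ z) → memB z τ ≡ false
∉⇒memB≡false τ ∉τ = ¬-not λ m → let k , e = memB⇒lookup τ m in ∉τ k e

memB-removeAt : ∀ {n ℓ} {z : Vertex n} (τ : Vec (Vertex n) (suc ℓ)) k →
  memB z τ ≡ true → z ≢ lookup τ k → memB z (removeAt τ k) ≡ true
memB-removeAt τ k m z≢ with memB⇒lookup τ m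
... | k′ , e with k ≟ᶠ k′
... | yes refl = contradiction (sym e) z≢
... | no k≢k′ = lookup⇒memB (removeAt τ k) (punchOut k≢k′) (trans (removeAt-punchOut τ k≢k′) e)

memB-insertAt-≢ : ∀ {n ℓ} {z : Vertex n} (τ : Vec (Vertex n) ℓ) i y →
  memB z (insertAt τ i y) ≡ true → z ≢ y → memB z τ ≡ true
memB-insertAt-≢ τ i y m z≢y with memB⇒lookup (insertAt τ i y) m
... | k , e with lookup-insertAt τ i y k
... | inj₁ e′ = contradiction (trans (sym e) e′) z≢y
... | inj₂ (k′ , e′) = lookup⇒memB τ k′ (trans (sym e′) e)

memB-insertAt⁺ : ∀ {n ℓ} {z : Vertex n} (τ : Vec (Vertex n) ℓ) i y →
  memB z τ ≡ true → memB z (insertAt τ i y) ≡ true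
memB-insertAt⁺ τ i y m with memB⇒lookup τ m
... | k , e = lookup⇒memB (insertAt τ i y) (punchIn i k) (trans (insertAt-punchIn τ i y k) e)

memB-insertAt-self : ∀ {n ℓ} (τ : Vec (Vertex n) ℓ) i y → memB y (insertAt τ i y) ≡ true
memB-insertAt-self τ i y = lookup⇒memB (insertAt τ i y) i (insertAt-lookup τ i y)

allB⇒lookup : ∀ {A : Set} {ℓ} (p : A → Bool) (u : Vec A ℓ) → allB p u ≡ true → ∀ k → p (lookup u k) ≡ true
allB⇒lookup p (x ∷ u) e zero = proj₁ (∧≡true e)
allB⇒lookup p (x ∷ u) e (suc k) = allB⇒lookup p u (proj₂ (∧≡true e)) k

lookup⇒allB : ∀ {A : Set} {ℓ} (p : A → Bool) (u : Vec A ℓ) → (∀ k → p (lookup u k) ≡ true) → allB p u ≡ true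
lookup⇒allB p [] h = refl
lookup⇒allB p (x ∷ u) h rewrite h zero = lookup⇒allB p u (λ k → h (suc k))

allB-false : ∀ {A : Set} {ℓ} (p : A → Bool) (u : Vec A ℓ) k → p (lookup u k) ≡ false → allB p u ≡ false
allB-false p u k e = ¬-not λ t → contradiction (trans (sym e) (allB⇒lookup p u t k)) λ ()

pigeonhole : ∀ {n L} (u : Vec (Vertex n) (suc L)) → Distinct u →
  (τ : Vec (Vertex n) L) → ¬ (∀ i → memB (lookup u i) τ ≡ true)
pigeonhole {L = zero} (a ∷ []) d [] u⊆τ with u⊆τ zero
... | ()
pigeonhole {L = suc L} (a ∷ u) d τ u⊆τ with memB⇒lookup τ (u⊆τ zero)
... | k , e = pigeonhole u (distinct-tail d) (removeAt τ k)
  λ i → memB-removeAt τ k (u⊆τ (suc i)) λ e′ → head∉tail d i (trans e′ e)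

bit : Bool → ℕ
bit b = if b then 1 else 0

countB-removeAt : ∀ {A : Set} {ℓ} (p : A → Bool) (B : Vec A (suc ℓ)) k →
  countB p B ≡ bit (p (lookup B k)) + countB p (removeAt B k)
countB-removeAt p (x ∷ xs) zero = refl
countB-removeAt p (x ∷ y ∷ ys) (suc k) rewrite countB-removeAt p (y ∷ ys) k =
  swap (bit (p x)) (bit (p (lookup (y ∷ ys) k))) (countB p (removeAt (y ∷ ys) k))
  where
  swap : ∀ a b c → a + (b + c) ≡ b + (a + c)
  swap = ℕ-Solver.solve-∀

countB-⊆ : ∀ {n L} (p : Vertex n → Bool) (A B : Vec (Vertex n) L) → Distinct A →
  (∀ i → memB (lookup A i) B ≡ true) → countB p A ≡ countB p B
countB-⊆ p [] [] d A⊆B = refl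
countB-⊆ p (a ∷ A) B d A⊆B with memB⇒lookup B (A⊆B zero)
... | k , refl = trans (cong (bit (p (lookup B k)) +_) (countB-⊆ p A (removeAt B k) (distinct-tail d)
    λ i → memB-removeAt B k (A⊆B (suc i)) (head∉tail d i)))
  (sym (countB-removeAt p B k))

increasingB-tail : ∀ {n ℓ} (t : Vertex n) (σ : Vec (Vertex n) ℓ) →
  increasingB (t ∷ σ) ≡ true → increasingB σ ≡ true
increasingB-tail t [] e = refl
increasingB-tail t (y ∷ ys) e = proj₂ (∧≡true e)

increasingB-head< : ∀ {n ℓ} (t : Vertex n) (σ : Vec (Vertex n) ℓ) → increasingB (t ∷ σ) ≡ true →
  ∀ k → val t < val (lookup σ k)
increasingB-head< t (y ∷ ys) e zero = <ᵇ≡true⇒< (proj₁ (∧≡true e))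
increasingB-head< t (y ∷ ys) e (suc k) =
  <-trans (<ᵇ≡true⇒< (proj₁ (∧≡true e))) (increasingB-head< y ys (proj₂ (∧≡true e)) k)

increasingB-∷ : ∀ {n ℓ} (t : Vertex n) (σ : Vec (Vertex n) ℓ) → (∀ k → val t < val (lookup σ k)) →
  increasingB (t ∷ σ) ≡ increasingB σ
increasingB-∷ t [] t<σ = refl
increasingB-∷ t (y ∷ ys) t<σ rewrite <⇒<ᵇ≡true (t<σ zero) = refl

increasingB-insertAt⁻ : ∀ {n ℓ} (τ : Vec (Vertex n) ℓ) i y →
  increasingB (insertAt τ i y) ≡ true → increasingB τ ≡ true
increasingB-insertAt⁻ τ zero y e = increasingB-tail y τ e
increasingB-insertAt⁻ (t ∷ τ) (suc i) y e = trans
  (increasingB-∷ t τ λ k → subst (λ z → val t < val z) (insertAt-punchIn τ i y k)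
    (increasingB-head< t (insertAt τ i y) e (punchIn i k)))
  (increasingB-insertAt⁻ τ i y (increasingB-tail t (insertAt τ i y) e))

increasingB⇒StrictlyIncreasing : ∀ {n ℓ} (σ : Vec (Vertex n) ℓ) → increasingB σ ≡ true → StrictlyIncreasing σ
increasingB⇒StrictlyIncreasing (t ∷ σ) e zero (suc j) _ = increasingB-head< t σ e j
increasingB⇒StrictlyIncreasing (t ∷ σ) e (suc i) (suc j) (s≤s i<j) =
  increasingB⇒StrictlyIncreasing σ (increasingB-tail t σ e) i j i<j

sgn-+ : ∀ a b → sgn (a + b) ≡ sgn a *ℤ sgn b
sgn-+ zero b = sym (ℤ.*-identityˡ (sgn b))
sgn-+ (suc a) b = trans (cong -_ (sgn-+ a b)) (ℤ.neg-distribˡ-* (sgn a) (sgn b))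

sgn-square : ∀ k → sgn k *ℤ sgn k ≡ 1ℤ
sgn-square zero = refl
sgn-square (suc k) = trans (neg*neg (sgn k)) (sgn-square k)
  where
  neg*neg : ∀ s → (- s) *ℤ (- s) ≡ s *ℤ s
  neg*neg = ℤ-Solver.solve-∀

sgn*≡0 : ∀ k {z} → z ≡ 0ℤ → sgn k *ℤ z ≡ 0ℤ
sgn*≡0 k refl = ℤ.*-zeroʳ (sgn k)

sgn-<ᵇ-opposite : ∀ {a b} → a ≢ b → sgn (bit (a <ᵇ b)) *ℤ sgn (bit (b <ᵇ a)) ≡ -1ℤ
sgn-<ᵇ-opposite {a} {b} a≢b with <-cmp a b
... | tri< a<b _ _ rewrite <⇒<ᵇ≡true a<b | >⇒<ᵇ≡false a<b = refl
... | tri≈ _ a≡b _ = contradiction a≡b a≢b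
... | tri> _ _ b<a rewrite <⇒<ᵇ≡true b<a | >⇒<ᵇ≡false b<a = refl

countBelow : ∀ {n ℓ} → Vertex n → Vec (Vertex n) ℓ → ℕ
countBelow a τ = countB (λ y → val y <ᵇ val a) τ

-- Removing u_j changes the inversion count by the number of pairs through position j, which is
-- j + countBelow u_j (u without j) modulo 2.
sgn-inversions-removeAt : ∀ {n L} (u : Vec (Vertex n) (suc L)) → Distinct u → ∀ j →
  sgn (countBelow (lookup u j) (removeAt u j)) *ℤ sgn (inversions u)
    ≡ sgn (toℕ j) *ℤ sgn (inversions (removeAt u j))
sgn-inversions-removeAt (b ∷ u) d zero = begin
  sgn c *ℤ sgn (c + inversions u)          ≡⟨ cong (sgn c *ℤ_) (sgn-+ c (inversions u)) ⟩
  sgn c *ℤ (sgn c *ℤ sgn (inversions u))   ≡⟨ ℤ.*-assoc (sgn c) (sgn c) _ ⟨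
  (sgn c *ℤ sgn c) *ℤ sgn (inversions u)   ≡⟨ cong (_*ℤ sgn (inversions u)) (sgn-square c) ⟩
  1ℤ *ℤ sgn (inversions u)                 ∎
  where
  open ≡-Reasoning
  c = countBelow b u
sgn-inversions-removeAt (b ∷ u@(_ ∷ _)) d (suc j) = begin
  sgn (bit β + countBelow a R) *ℤ sgn (countBelow b u + inversions u)
    ≡⟨ cong₂ _*ℤ_ (sgn-+ (bit β) (countBelow a R))
         (trans (sgn-+ (countBelow b u) (inversions u)) (cong (_*ℤ sgn (inversions u)) b-below)) ⟩
  (X *ℤ sgn (countBelow a R)) *ℤ ((Y *ℤ sgn (countBelow b R)) *ℤ sgn (inversions u))
    ≡⟨ regroup X (sgn (countBelow a R)) Y (sgn (countBelow b R)) (sgn (inversions u)) ⟩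
  (X *ℤ Y) *ℤ (sgn (countBelow b R) *ℤ (sgn (countBelow a R) *ℤ sgn (inversions u)))
    ≡⟨ cong₂ (λ p q → p *ℤ (sgn (countBelow b R) *ℤ q))
         (sgn-<ᵇ-opposite b≢a) (sgn-inversions-removeAt u (distinct-tail d) j) ⟩
  -1ℤ *ℤ (sgn (countBelow b R) *ℤ (sgn (toℕ j) *ℤ sgn (inversions R)))
    ≡⟨ trans (ℤ.-1*i≡-i _) (negate-middle (sgn (countBelow b R)) (sgn (toℕ j)) (sgn (inversions R))) ⟩
  (- sgn (toℕ j)) *ℤ (sgn (countBelow b R) *ℤ sgn (inversions R))
    ≡⟨ cong ((- sgn (toℕ j)) *ℤ_) (sgn-+ (countBelow b R) (inversions R)) ⟨
  (- sgn (toℕ j)) *ℤ sgn (countBelow b R + inversions R) ∎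
  where
  open ≡-Reasoning
  a = lookup u j
  R = removeAt u j
  β = val b <ᵇ val a
  β′ = val a <ᵇ val b
  X = sgn (bit β)
  Y = sgn (bit β′)
  b≢a : val b ≢ val a
  b≢a e = head∉tail d j (val-injective a b (sym e))
  b-below : sgn (countBelow b u) ≡ Y *ℤ sgn (countBelow b R)
  b-below = trans (cong sgn (countB-removeAt (λ y → val y <ᵇ val b) u j)) (sgn-+ (bit β′) (countBelow b R))
  regroup : ∀ x p y q i → (x *ℤ p) *ℤ ((y *ℤ q) *ℤ i) ≡ (x *ℤ y) *ℤ (q *ℤ (p *ℤ i))
  regroup = ℤ-Solver.solve-∀
  negate-middle : ∀ q s t → - (q *ℤ (s *ℤ t)) ≡ (- s) *ℤ (q *ℤ t)
  negate-middle = ℤ-Solver.solve-∀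

module _ {A : Set} where

  sumℤ-cong : {f g : A → ℤ} (l : List A) → (∀ a → f a ≡ g a) → sumℤ (map f l) ≡ sumℤ (map g l)
  sumℤ-cong [] f≗g = refl
  sumℤ-cong (x ∷ l) f≗g = cong₂ _+ℤ_ (f≗g x) (sumℤ-cong l f≗g)

  sumℤ-zero : {f : A → ℤ} (l : List A) → (∀ a → f a ≡ 0ℤ) → sumℤ (map f l) ≡ 0ℤ
  sumℤ-zero [] f≗0 = refl
  sumℤ-zero (x ∷ l) f≗0 = cong₂ _+ℤ_ (f≗0 x) (sumℤ-zero l f≗0)

  *-distribˡ-sumℤ : (k : ℤ) (f : A → ℤ) (l : List A) → k *ℤ sumℤ (map f l) ≡ sumℤ (map (λ a → k *ℤ f a) l)
  *-distribˡ-sumℤ k f [] = ℤ.*-zeroʳ k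
  *-distribˡ-sumℤ k f (x ∷ l) = trans (ℤ.*-distribˡ-+ k (f x) _) (cong (k *ℤ f x +ℤ_) (*-distribˡ-sumℤ k f l))

  sumℤ-+ : (f g : A → ℤ) (l : List A) → sumℤ (map (λ a → f a +ℤ g a) l) ≡ sumℤ (map f l) +ℤ sumℤ (map g l)
  sumℤ-+ f g [] = refl
  sumℤ-+ f g (x ∷ l) = trans (cong (f x +ℤ g x +ℤ_) (sumℤ-+ f g l)) (interchange (f x) (g x) _ _)
    where
    interchange : ∀ a b c d → a +ℤ b +ℤ (c +ℤ d) ≡ a +ℤ c +ℤ (b +ℤ d)
    interchange = ℤ-Solver.solve-∀

  sumℤ≢0⇒ : (f : A → ℤ) (l : List A) → sumℤ (map f l) ≢ 0ℤ → ∃ λ a → f a ≢ 0ℤ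
  sumℤ≢0⇒ f [] sum≢0 = contradiction refl sum≢0
  sumℤ≢0⇒ f (x ∷ l) sum≢0 with f x Data.Integer.≟ 0ℤ
  ... | no fx≢0 = x , fx≢0
  ... | yes fx≡0 = sumℤ≢0⇒ f l λ e → sum≢0 (cong₂ _+ℤ_ fx≡0 e)

sumℤ-comm : ∀ {A B : Set} (F : A → B → ℤ) (l₁ : List A) (l₂ : List B) →
  sumℤ (map (λ a → sumℤ (map (F a) l₂)) l₁) ≡ sumℤ (map (λ b → sumℤ (map (λ a → F a b) l₁)) l₂)
sumℤ-comm F [] l₂ = sym (sumℤ-zero l₂ λ _ → refl)
sumℤ-comm F (x ∷ l₁) l₂ = trans (cong (sumℤ (map (F x) l₂) +ℤ_) (sumℤ-comm F l₁ l₂))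
  (sym (sumℤ-+ (F x) (λ b → sumℤ (map (λ a → F a b) l₁)) l₂))

sumℤ-tabulate : ∀ {A : Set} {k} (f : A → ℤ) (g : Fin k → A) →
  sumℤ (map f (List.tabulate g)) ≡ sum (λ i → f (g i))
sumℤ-tabulate {k = zero} f g = refl
sumℤ-tabulate {k = suc k} f g = cong (f (g zero) +ℤ_) (sumℤ-tabulate f (λ i → g (suc i)))

sumℤ-allFin : ∀ {k} (f : Fin k → ℤ) → sumℤ (map f (allFin k)) ≡ sum f
sumℤ-allFin f = sumℤ-tabulate f (λ i → i)

sum-zero : ∀ {k} {f : Fin k → ℤ} → (∀ i → f i ≡ 0ℤ) → sum f ≡ 0ℤ
sum-zero {k} f≗0 = trans (sum-cong-≗ f≗0) (sum-replicate-zero k)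

sum-neg : ∀ {k} (f : Fin k → ℤ) → sum (λ i → - f i) ≡ - sum f
sum-neg {zero} f = refl
sum-neg {suc k} f = trans (cong (- f zero +ℤ_) (sum-neg (λ i → f (suc i)))) (sym (ℤ.neg-distrib-+ (f zero) _))

sum-point : ∀ {k} (f : Fin (suc k) → ℤ) j → (∀ i → i ≢ j → f i ≡ 0ℤ) → sum f ≡ f j
sum-point f j f≗0 = begin
  sum f                                  ≡⟨ sum-remove f ⟩
  f j +ℤ sum (λ i → f (punchIn j i))
    ≡⟨ cong (f j +ℤ_) (sum-zero λ i → f≗0 (punchIn j i) (punchInᵢ≢i j i)) ⟩
  f j +ℤ 0ℤ                              ≡⟨ ℤ.+-identityʳ (f j) ⟩
  f j                                    ∎
  where open ≡-Reasoning

sumℤ-allVertices-suc : ∀ {n} (f : Vertex (suc n) → ℤ) →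
  sumℤ (map f (allVertices (suc n))) ≡ sumℤ (map (λ xs → f (false ∷ xs) +ℤ f (true ∷ xs)) (allVertices n))
sumℤ-allVertices-suc {n} f = go (allVertices n)
  where
  go : ∀ l → sumℤ (map f (concatMap (λ xs → (false ∷ xs) ∷ (true ∷ xs) ∷ []) l))
           ≡ sumℤ (map (λ xs → f (false ∷ xs) +ℤ f (true ∷ xs)) l)
  go [] = refl
  go (xs ∷ l) = trans (cong (λ s → f (false ∷ xs) +ℤ (f (true ∷ xs) +ℤ s)) (go l))
    (sym (ℤ.+-assoc (f (false ∷ xs)) (f (true ∷ xs)) _))

sumℤ-allVertices-point : ∀ {n} (f : Vertex n → ℤ) a → (∀ y → y ≢ a → f y ≡ 0ℤ) →
  sumℤ (map f (allVertices n)) ≡ f a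
sumℤ-allVertices-point {zero} f [] _ = ℤ.+-identityʳ (f [])
sumℤ-allVertices-point {suc n} f (b ∷ a) f≗0 = trans (sumℤ-allVertices-suc f)
  (trans (sumℤ-allVertices-point _ a λ y y≢a → cong₂ _+ℤ_ (f≗0 _ (y≢a ∘∷)) (f≗0 _ (y≢a ∘∷)))
         (column b f≗0))
  where
  _∘∷ : ∀ {y c c′} → y ≢ a → c ∷ y ≢ c′ ∷ a
  (y≢a ∘∷) e = y≢a (cong tail e)
  column : ∀ c → (∀ y → y ≢ c ∷ a → f y ≡ 0ℤ) → f (false ∷ a) +ℤ f (true ∷ a) ≡ f (c ∷ a)
  column false f≗0 = trans (cong (f (false ∷ a) +ℤ_) (f≗0 (true ∷ a) λ ())) (ℤ.+-identityʳ _)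
  column true f≗0 = trans (cong (_+ℤ f (true ∷ a)) (f≗0 (false ∷ a) λ ())) (ℤ.+-identityˡ _)

sumℤ-allVertices-flip : ∀ {m} (j : Fin m) (g : Vec Bool m → ℤ) → (∀ ε → g (updateAt ε j not) ≡ - g ε) →
  sumℤ (map g (allVertices m)) ≡ 0ℤ
sumℤ-allVertices-flip {suc m} zero g g-odd = trans (sumℤ-allVertices-suc g)
  (sumℤ-zero (allVertices m) λ xs →
    trans (cong (g (false ∷ xs) +ℤ_) (g-odd (false ∷ xs))) (ℤ.+-inverseʳ (g (false ∷ xs))))
sumℤ-allVertices-flip {suc m} (suc j) g g-odd = trans (sumℤ-allVertices-suc g)
  (trans (sumℤ-+ (λ xs → g (false ∷ xs)) (λ xs → g (true ∷ xs)) (allVertices m))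
    (cong₂ _+ℤ_ (sumℤ-allVertices-flip j _ λ ε → g-odd (false ∷ ε))
                (sumℤ-allVertices-flip j _ λ ε → g-odd (true ∷ ε))))

countBelow-below-all : ∀ {n ℓ} (a : Vertex n) (τ : Vec (Vertex n) ℓ) → (∀ k → val a < val (lookup τ k)) →
  countBelow a τ ≡ 0
countBelow-below-all a [] _ = refl
countBelow-below-all a (y ∷ ys) a< rewrite >⇒<ᵇ≡false (a< zero) = countBelow-below-all a ys (λ k → a< (suc k))

increasingB-∷-insertAt-below : ∀ {n ℓ} t (τ : Vec (Vertex n) ℓ) i a → val a < val t →
  increasingB (t ∷ insertAt τ i a) ≡ false
increasingB-∷-insertAt-below t τ i a a<t = ¬-not λ sorted → <-asym a<t
  (subst (λ z → val t < val z) (insertAt-lookup τ i a) (increasingB-head< t (insertAt τ i a) sorted i))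

increasingB-∷-insertAt-above : ∀ {n ℓ} t (τ : Vec (Vertex n) ℓ) i a →
  increasingB (t ∷ τ) ≡ true → val t < val a →
  increasingB (t ∷ insertAt τ i a) ≡ increasingB (insertAt τ i a)
increasingB-∷-insertAt-above t τ i a sorted t<a = increasingB-∷ t (insertAt τ i a) t<all
  where
  t<all : ∀ k → val t < val (lookup (insertAt τ i a) k)
  t<all k with lookup-insertAt τ i a k
  ... | inj₁ e = subst (λ z → val t < val z) (sym e) t<a
  ... | inj₂ (k′ , e) = subst (λ z → val t < val z) (sym e) (increasingB-head< t τ sorted k′)

-- Exactly one position keeps the insertion sorted, namely the one after the countBelow a τ
-- smaller entries.
sum-sgn-insertAt-sorted : ∀ {n L} (τ : Vec (Vertex n) L) a s → increasingB τ ≡ true → (∀ k → lookup τ k ≢ a) →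
  sum (λ i → sgn (toℕ i) *ℤ (if increasingB (insertAt τ i a) then s else 0ℤ)) ≡ sgn (countBelow a τ) *ℤ s
sum-sgn-insertAt-sorted [] a s _ _ = ℤ.+-identityʳ _
sum-sgn-insertAt-sorted (t ∷ τ) a s sorted a∉ with <-cmp (val a) (val t)
... | tri≈ _ a≡t _ = contradiction (sym (val-injective a t a≡t)) (a∉ zero)
... | tri< a<t _ _ = begin
  1ℤ *ℤ (if increasingB (a ∷ t ∷ τ) then s else 0ℤ) +ℤ sum later
    ≡⟨ cong₂ (λ b l → 1ℤ *ℤ (if b then s else 0ℤ) +ℤ l) (trans (increasingB-∷ a (t ∷ τ) a<all) sorted)
         (sum-zero λ i → sgn*≡0 (suc (toℕ i))
           (cong (λ b → if b then s else 0ℤ) (increasingB-∷-insertAt-below t τ i a a<t))) ⟩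
  1ℤ *ℤ s +ℤ 0ℤ                     ≡⟨ ℤ.+-identityʳ _ ⟩
  sgn 0 *ℤ s                        ≡⟨ cong (λ c → sgn c *ℤ s) (countBelow-below-all a (t ∷ τ) a<all) ⟨
  sgn (countBelow a (t ∷ τ)) *ℤ s   ∎
  where
  open ≡-Reasoning
  later : Fin _ → ℤ
  later i = sgn (suc (toℕ i)) *ℤ (if increasingB (t ∷ insertAt τ i a) then s else 0ℤ)
  a<all : ∀ k → val a < val (lookup (t ∷ τ) k)
  a<all zero = a<t
  a<all (suc k) = <-trans a<t (increasingB-head< t τ sorted k)
... | tri> _ _ t<a = begin
  1ℤ *ℤ (if (val a <ᵇ val t) ∧ increasingB (t ∷ τ) then s else 0ℤ) +ℤ sum later
    ≡⟨ cong (λ b → 1ℤ *ℤ (if b ∧ increasingB (t ∷ τ) then s else 0ℤ) +ℤ sum later) (>⇒<ᵇ≡false t<a) ⟩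
  0ℤ +ℤ sum later                         ≡⟨ ℤ.+-identityˡ _ ⟩
  sum later                               ≡⟨ sum-cong-≗ later≡-earlier ⟩
  sum (λ i → - earlier i)                 ≡⟨ sum-neg earlier ⟩
  - sum earlier
    ≡⟨ cong -_ (sum-sgn-insertAt-sorted τ a s (increasingB-tail t τ sorted) (a∉ ∘ suc)) ⟩
  - (sgn (countBelow a τ) *ℤ s)           ≡⟨ ℤ.neg-distribˡ-* (sgn (countBelow a τ)) s ⟩
  sgn (bit true + countBelow a τ) *ℤ s    ≡⟨ cong (λ b → sgn (bit b + countBelow a τ) *ℤ s) (<⇒<ᵇ≡true t<a) ⟨
  sgn (countBelow a (t ∷ τ)) *ℤ s         ∎
  where
  open ≡-Reasoning
  later earlier : Fin _ → ℤ
  later i = sgn (suc (toℕ i)) *ℤ (if increasingB (t ∷ insertAt τ i a) then s else 0ℤ)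
  earlier i = sgn (toℕ i) *ℤ (if increasingB (insertAt τ i a) then s else 0ℤ)
  later≡-earlier : ∀ i → later i ≡ - earlier i
  later≡-earlier i = trans
    (cong (λ b → sgn (suc (toℕ i)) *ℤ (if b then s else 0ℤ)) (increasingB-∷-insertAt-above t τ i a sorted t<a))
    (sym (ℤ.neg-distribˡ-* (sgn (toℕ i)) _))

_⊆ᵇ_ : ∀ {n k ℓ} → Vec (Vertex n) k → Vec (Vertex n) ℓ → Bool
u ⊆ᵇ τ = allB (λ x → memB x τ) u

oriented-unsorted : ∀ {n ℓ} (u : Vec (Vertex n) ℓ) σ → increasingB σ ≡ false → oriented u σ ≡ 0ℤ
oriented-unsorted u σ e = cong (λ b → if b ∧ (u ⊆ᵇ σ) then sgn (inversions u) else 0ℤ) e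

oriented-uncovered : ∀ {n ℓ} (u : Vec (Vertex n) ℓ) σ → (u ⊆ᵇ σ) ≡ false → oriented u σ ≡ 0ℤ
oriented-uncovered u σ e = cong (λ b → if b then sgn (inversions u) else 0ℤ) (∧-falseʳ (increasingB σ) e)

oriented-covered : ∀ {n ℓ} (u : Vec (Vertex n) ℓ) σ → (u ⊆ᵇ σ) ≡ true →
  oriented u σ ≡ (if increasingB σ then sgn (inversions u) else 0ℤ)
oriented-covered u σ e =
  cong (λ b → if b then sgn (inversions u) else 0ℤ) (trans (cong (increasingB σ ∧_) e) (∧-identityʳ (increasingB σ)))

oriented-sorted : ∀ {n ℓ} (u : Vec (Vertex n) ℓ) σ → increasingB σ ≡ true → (u ⊆ᵇ σ) ≡ true →
  oriented u σ ≡ sgn (inversions u)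
oriented-sorted u σ sorted cov = trans (oriented-covered u σ cov) (cong (λ b → if b then sgn (inversions u) else 0ℤ) sorted)

alternatingFaces : ∀ {n L} → Vec (Vertex n) (suc L) → Chain n L
alternatingFaces u τ = sum λ j → sgn (toℕ j) *ℤ oriented (removeAt u j) τ

insertAt-covering : ∀ {n L} (u : Vec (Vertex n) (suc L)) → Distinct u → ∀ τ i x → (u ⊆ᵇ insertAt τ i x) ≡ true →
  ∃ λ j → lookup u j ≡ x × (removeAt u j ⊆ᵇ τ) ≡ true
insertAt-covering u d τ i x cov = case any? (λ j → lookup u j ≟ᵛ x) of λ where
    (yes (j , uj≡x)) → j , uj≡x , lookup⇒allB _ (removeAt u j) λ k →
      subst (λ z → memB z τ ≡ true) (sym (lookup-removeAt u j k))
        (in-τ (punchIn j k) λ e → punchInᵢ≢i j k (d _ _ (trans e (sym uj≡x))))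
    (no x∉u) → contradiction (λ k → in-τ k λ e → x∉u (k , e)) (pigeonhole u d τ)
  where
  in-τ : ∀ k → lookup u k ≢ x → memB (lookup u k) τ ≡ true
  in-τ k = memB-insertAt-≢ τ i x (allB⇒lookup _ u cov k)

∂-oriented-vanishing : ∀ {n L} (u : Vec (Vertex n) (suc L)) τ →
  (∀ i x → oriented u (insertAt τ i x) ≡ 0ℤ) → ∂ (oriented u) τ ≡ 0ℤ
∂-oriented-vanishing {n} {L} u τ vanish =
  trans (sumℤ-allFin insertions) (sum-zero λ i → sumℤ-zero (allVertices n) λ x → sgn*≡0 (toℕ i) (vanish i x))
  where
  insertions : Fin (suc L) → ℤ
  insertions i = sumℤ (map (λ x → sgn (toℕ i) *ℤ oriented u (insertAt τ i x)) (allVertices n))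

∂-oriented-face : ∀ {n L} (u : Vec (Vertex n) (suc L)) → Distinct u → ∀ τ j₀ →
  increasingB τ ≡ true → (removeAt u j₀ ⊆ᵇ τ) ≡ true → ∂ (oriented u) τ ≡ alternatingFaces u τ
∂-oriented-face {n} u d τ j₀ sorted face = begin
  ∂ (oriented u) τ
    ≡⟨ sumℤ-allFin (λ i → sumℤ (map (λ x → sgn (toℕ i) *ℤ oriented u (insertAt τ i x)) (allVertices n))) ⟩
  sum (λ i → sumℤ (map (λ x → sgn (toℕ i) *ℤ oriented u (insertAt τ i x)) (allVertices n)))
    ≡⟨ sum-cong-≗ (λ i → sumℤ-allVertices-point _ a (insert-other i)) ⟩
  sum (λ i → sgn (toℕ i) *ℤ oriented u (insertAt τ i a))
    ≡⟨ sum-cong-≗ (λ i → cong (sgn (toℕ i) *ℤ_) (oriented-covered u (insertAt τ i a) (covered-by-insert i))) ⟩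
  sum (λ i → sgn (toℕ i) *ℤ (if increasingB (insertAt τ i a) then sgn (inversions u) else 0ℤ))
    ≡⟨ sum-sgn-insertAt-sorted τ a _ sorted a∉τ ⟩
  sgn (countBelow a τ) *ℤ sgn (inversions u)
    ≡⟨ cong (λ c → sgn c *ℤ sgn (inversions u))
         (countB-⊆ _ (removeAt u j₀) τ (distinct-removeAt u j₀ d) (allB⇒lookup _ (removeAt u j₀) face)) ⟨
  sgn (countBelow a (removeAt u j₀)) *ℤ sgn (inversions u)
    ≡⟨ sgn-inversions-removeAt u d j₀ ⟩
  sgn (toℕ j₀) *ℤ sgn (inversions (removeAt u j₀))
    ≡⟨ cong (sgn (toℕ j₀) *ℤ_) (oriented-sorted (removeAt u j₀) τ sorted face) ⟨
  sgn (toℕ j₀) *ℤ oriented (removeAt u j₀) τ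
    ≡⟨ sum-point _ j₀ drop-other ⟨
  alternatingFaces u τ ∎
  where
  open ≡-Reasoning
  a = lookup u j₀
  others∈τ : ∀ {i} → j₀ ≢ i → memB (lookup u i) τ ≡ true
  others∈τ j₀≢i = subst (λ z → memB z τ ≡ true) (removeAt-punchOut u j₀≢i)
    (allB⇒lookup _ (removeAt u j₀) face (punchOut j₀≢i))
  a∉τ : ∀ k → lookup τ k ≢ a
  a∉τ k e = pigeonhole u d τ λ i → case (j₀ ≟ᶠ i) of λ where
    (yes refl) → lookup⇒memB τ k e
    (no j₀≢i) → others∈τ j₀≢i
  insert-other : ∀ i y → y ≢ a → sgn (toℕ i) *ℤ oriented u (insertAt τ i y) ≡ 0ℤ
  insert-other i y y≢a = sgn*≡0 (toℕ i) (oriented-uncovered u (insertAt τ i y) (allB-false _ u j₀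
    (¬-not λ m → a∉τ _ (proj₂ (memB⇒lookup τ (memB-insertAt-≢ τ i y m (y≢a ∘ sym)))))))
  covered-by-insert : ∀ i → (u ⊆ᵇ insertAt τ i a) ≡ true
  covered-by-insert i = lookup⇒allB _ u λ k → case (j₀ ≟ᶠ k) of λ where
    (yes refl) → memB-insertAt-self τ i a
    (no j₀≢k) → memB-insertAt⁺ τ i a (others∈τ j₀≢k)
  drop-other : ∀ j → j ≢ j₀ → sgn (toℕ j) *ℤ oriented (removeAt u j) τ ≡ 0ℤ
  drop-other j j≢j₀ = sgn*≡0 (toℕ j) (oriented-uncovered (removeAt u j) τ (allB-false _ (removeAt u j) (punchOut j≢j₀)
    (subst (λ z → memB z τ ≡ false) (sym (removeAt-punchOut u j≢j₀)) (∉⇒memB≡false τ a∉τ))))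

∂-oriented : ∀ {n L} (u : Vec (Vertex n) (suc L)) → Distinct u → ∀ τ → ∂ (oriented u) τ ≡ alternatingFaces u τ
∂-oriented u d τ with any? (λ j → (removeAt u j ⊆ᵇ τ) ≟ᵇ true) | increasingB τ ≟ᵇ true
... | yes (j₀ , face) | yes sorted = ∂-oriented-face u d τ j₀ sorted face
... | yes _ | no unsorted = trans
  (∂-oriented-vanishing u τ λ i x →
    oriented-unsorted u (insertAt τ i x) (¬-not (unsorted ∘ increasingB-insertAt⁻ τ i x)))
  (sym (sum-zero λ j → sgn*≡0 (toℕ j) (oriented-unsorted (removeAt u j) τ (¬-not unsorted))))
... | no no-face | _ = trans
  (∂-oriented-vanishing u τ λ i x → oriented-uncovered u (insertAt τ i x) (¬-not λ cov →
    let j , _ , face = insertAt-covering u d τ i x cov in no-face (j , face)))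
  (sym (sum-zero λ j → sgn*≡0 (toℕ j) (oriented-uncovered (removeAt u j) τ (¬-not λ face → no-face (j , face)))))

∂-linear : ∀ {n ℓ} {A : Set} (g : A → ℤ) (c : A → Chain n (suc ℓ)) (l : List A) τ →
  ∂ (λ σ → sumℤ (map (λ a → g a *ℤ c a σ) l)) τ ≡ sumℤ (map (λ a → g a *ℤ ∂ (c a) τ) l)
∂-linear {n} {ℓ} g c l τ = begin
  sumℤ (map (λ i → sumℤ (map (λ x → sgn (toℕ i) *ℤ sumℤ (map (λ a → g a *ℤ c a (insertAt τ i x)) l)) V)) I)
    ≡⟨ sumℤ-cong I (λ i → sumℤ-cong V λ x → *-distribˡ-sumℤ (sgn (toℕ i)) _ l) ⟩
  sumℤ (map (λ i → sumℤ (map (λ x → sumℤ (map (λ a → F a i x) l)) V)) I)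
    ≡⟨ sumℤ-cong I (λ i → sumℤ-comm (λ x a → F a i x) V l) ⟩
  sumℤ (map (λ i → sumℤ (map (λ a → sumℤ (map (F a i) V)) l)) I)
    ≡⟨ sumℤ-comm (λ i a → sumℤ (map (F a i) V)) I l ⟩
  sumℤ (map (λ a → sumℤ (map (λ i → sumℤ (map (F a i) V)) I)) l)
    ≡⟨ sumℤ-cong l factor-out ⟩
  sumℤ (map (λ a → g a *ℤ ∂ (c a) τ) l) ∎
  where
  open ≡-Reasoning
  V = allVertices n
  I = allFin (suc ℓ)
  F : _ → Fin (suc ℓ) → Vertex n → ℤ
  F a i x = sgn (toℕ i) *ℤ (g a *ℤ c a (insertAt τ i x))
  left-comm : ∀ p q s → p *ℤ (q *ℤ s) ≡ q *ℤ (p *ℤ s)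
  left-comm = ℤ-Solver.solve-∀
  factor-out : ∀ a → sumℤ (map (λ i → sumℤ (map (F a i) V)) I) ≡ g a *ℤ ∂ (c a) τ
  factor-out a = sym (trans (*-distribˡ-sumℤ (g a) _ I) (sumℤ-cong I λ i →
    trans (*-distribˡ-sumℤ (g a) _ V) (sumℤ-cong V λ x → left-comm (g a) (sgn (toℕ i)) _)))

covering-is-onto : ∀ {n ℓ} (u σ : Vec (Vertex n) ℓ) → Distinct u → (u ⊆ᵇ σ) ≡ true →
  ∀ k → ∃ λ p → lookup u p ≡ lookup σ k
covering-is-onto {ℓ = suc ℓ} u σ d cov k with any? (λ p → lookup u p ≟ᵛ lookup σ k)
... | yes found = found
... | no σk∉u = contradiction
  (λ i → memB-removeAt σ k (allB⇒lookup _ u cov i) λ e → σk∉u (i , e)) (pigeonhole u d (removeAt σ k))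

oriented-VR : ∀ {n ℓ r} (u σ : Vec (Vertex n) ℓ) → Distinct u → (∀ p q → dH (lookup u p) (lookup u q) ≤ r) →
  oriented u σ ≢ 0ℤ → IsVRSimplex r σ
oriented-VR u σ d diam o≢0 with increasingB σ ≟ᵇ true | (u ⊆ᵇ σ) ≟ᵇ true
... | no unsorted | _ = contradiction (oriented-unsorted u σ (¬-not unsorted)) o≢0
... | yes _ | no uncovered = contradiction (oriented-uncovered u σ (¬-not uncovered)) o≢0
... | yes sorted | yes cov = increasingB⇒StrictlyIncreasing σ sorted , λ k k′ →
  let p , up≡σk = covering-is-onto u σ d cov k
      q , uq≡σk′ = covering-is-onto u σ d cov k′
  in subst₂ (λ a b → dH a b ≤ _) up≡σk uq≡σk′ (diam p q)

pick : ∀ {n m} → (Fin m → Vertex n) → (Fin m → Vertex n) → Vec Bool m → Fin m → Vertex n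
pick v w ε i = if lookup ε i then w i else v i

facet : ∀ {n m} → (Fin m → Vertex n) → (Fin m → Vertex n) → Vec Bool m → Vec (Vertex n) m
facet v w ε = tabulate (pick v w ε)

lookup-facet : ∀ {n m} (v w : Fin m → Vertex n) ε i → lookup (facet v w ε) i ≡ pick v w ε i
lookup-facet v w ε = lookup∘tabulate (pick v w ε)

facetSign : ∀ {m} → Vec Bool m → ℤ
facetSign ε = sgn (countB (λ b → b) ε)

facetSign-flip : ∀ {m} (j : Fin m) ε → facetSign (updateAt ε j not) ≡ - facetSign ε
facetSign-flip zero (false ∷ ε) = refl
facetSign-flip zero (true ∷ ε) = sym (ℤ.neg-involutive _)
facetSign-flip (suc j) (false ∷ ε) = facetSign-flip j ε
facetSign-flip (suc j) (true ∷ ε) = cong -_ (facetSign-flip j ε)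

removeAt-tabulate : ∀ {A : Set} {k} (f : Fin (suc k) → A) j → removeAt (tabulate f) j ≡ tabulate (λ i → f (punchIn j i))
removeAt-tabulate f zero = refl
removeAt-tabulate {k = suc k} f (suc j) = cong (f zero ∷_) (removeAt-tabulate (λ i → f (suc i)) j)

removeAt-facet-flip : ∀ {n m} (v w : Fin (suc m) → Vertex n) j ε →
  removeAt (facet v w (updateAt ε j not)) j ≡ removeAt (facet v w ε) j
removeAt-facet-flip v w j ε = begin
  removeAt (facet v w (updateAt ε j not)) j                    ≡⟨ removeAt-tabulate (pick v w (updateAt ε j not)) j ⟩
  tabulate (λ i → pick v w (updateAt ε j not) (punchIn j i))   ≡⟨ tabulate-cong kept ⟩
  tabulate (λ i → pick v w ε (punchIn j i))                    ≡⟨ removeAt-tabulate (pick v w ε) j ⟨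
  removeAt (facet v w ε) j                                     ∎
  where
  open ≡-Reasoning
  kept : ∀ i → pick v w (updateAt ε j not) (punchIn j i) ≡ pick v w ε (punchIn j i)
  kept i = cong (λ b → if b then w (punchIn j i) else v (punchIn j i))
    (lookup∘updateAt′ (punchIn j i) j (punchInᵢ≢i j i) ε)

coneCross : ∀ {n m} → Vertex n → (Fin m → Vertex n) → (Fin m → Vertex n) → Chain n (suc m)
coneCross {m = m} x v w σ = sumℤ (map (λ ε → facetSign ε *ℤ oriented (x ∷ facet v w ε) σ) (allBoolVecs m))

-- Flipping ε at j leaves the face opposite position j unchanged and negates the sign.
cone-faces-cancel : ∀ {n m} (x : Vertex n) (v w : Fin (suc m) → Vertex n) τ →
  sumℤ (map (λ ε → facetSign ε *ℤ sum (λ j → sgn (suc (toℕ j)) *ℤ oriented (x ∷ removeAt (facet v w ε) j) τ))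
            (allBoolVecs (suc m)))
  ≡ 0ℤ
cone-faces-cancel {m = m} x v w τ = begin
  sumℤ (map (λ ε → facetSign ε *ℤ sum (K ε)) E)
    ≡⟨ sumℤ-cong E (λ ε → trans (cong (facetSign ε *ℤ_) (sym (sumℤ-allFin (K ε))))
                                (*-distribˡ-sumℤ (facetSign ε) (K ε) J)) ⟩
  sumℤ (map (λ ε → sumℤ (map (λ j → facetSign ε *ℤ K ε j) J)) E)
    ≡⟨ sumℤ-comm (λ ε j → facetSign ε *ℤ K ε j) E J ⟩
  sumℤ (map (λ j → sumℤ (map (λ ε → facetSign ε *ℤ K ε j) E)) J)
    ≡⟨ sumℤ-zero J (λ j → sumℤ-allVertices-flip j _ (flip-odd j)) ⟩
  0ℤ ∎
  where
  open ≡-Reasoning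
  E = allBoolVecs (suc m)
  J = allFin (suc m)
  K : Vec Bool (suc m) → Fin (suc m) → ℤ
  K ε j = sgn (suc (toℕ j)) *ℤ oriented (x ∷ removeAt (facet v w ε) j) τ
  flip-odd : ∀ j ε → facetSign (updateAt ε j not) *ℤ K (updateAt ε j not) j ≡ - (facetSign ε *ℤ K ε j)
  flip-odd j ε = trans
    (cong₂ (λ s f → s *ℤ (sgn (suc (toℕ j)) *ℤ oriented (x ∷ f) τ))
      (facetSign-flip j ε) (removeAt-facet-flip v w j ε))
    (sym (ℤ.neg-distribˡ-* (facetSign ε) (K ε j)))

∂-coneCross : ∀ {n m} (x : Vertex n) (v w : Fin (suc m) → Vertex n) → (∀ ε → Distinct (x ∷ facet v w ε)) →
  ∀ τ → ∂ (coneCross x v w) τ ≡ crossCycle v w τ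
∂-coneCross {m = m} x v w distinct τ = begin
  ∂ (coneCross x v w) τ
    ≡⟨ ∂-linear facetSign (λ ε → oriented (x ∷ facet v w ε)) E τ ⟩
  sumℤ (map (λ ε → facetSign ε *ℤ ∂ (oriented (x ∷ facet v w ε)) τ) E)
    ≡⟨ sumℤ-cong E (λ ε → cong (facetSign ε *ℤ_)
         (trans (∂-oriented _ (distinct ε) τ) (cong (_+ℤ faces ε) (ℤ.*-identityˡ (oriented (facet v w ε) τ))))) ⟩
  sumℤ (map (λ ε → facetSign ε *ℤ (oriented (facet v w ε) τ +ℤ faces ε)) E)
    ≡⟨ sumℤ-cong E (λ ε → ℤ.*-distribˡ-+ (facetSign ε) (oriented (facet v w ε) τ) (faces ε)) ⟩
  sumℤ (map (λ ε → facetSign ε *ℤ oriented (facet v w ε) τ +ℤ facetSign ε *ℤ faces ε) E)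
    ≡⟨ sumℤ-+ _ _ E ⟩
  crossCycle v w τ +ℤ sumℤ (map (λ ε → facetSign ε *ℤ faces ε) E)
    ≡⟨ cong (crossCycle v w τ +ℤ_) (cone-faces-cancel x v w τ) ⟩
  crossCycle v w τ +ℤ 0ℤ
    ≡⟨ ℤ.+-identityʳ _ ⟩
  crossCycle v w τ ∎
  where
  open ≡-Reasoning
  E = allBoolVecs (suc m)
  faces : Vec Bool (suc m) → ℤ
  faces ε = sum (λ j → sgn (suc (toℕ j)) *ℤ oriented (x ∷ removeAt (facet v w ε) j) τ)

coneCross-VR : ∀ {n m r} (x : Vertex n) (v w : Fin m → Vertex n) → (∀ ε → Distinct (x ∷ facet v w ε)) →
  (∀ ε p q → dH (lookup (x ∷ facet v w ε) p) (lookup (x ∷ facet v w ε) q) ≤ r) → IsVRChain r (coneCross x v w)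
coneCross-VR {m = m} x v w distinct diam σ cone≢0 =
  let ε , term≢0 = sumℤ≢0⇒ _ (allBoolVecs m) cone≢0
  in oriented-VR (x ∷ facet v w ε) σ (distinct ε) (diam ε)
       λ o≡0 → term≢0 (trans (cong (facetSign ε *ℤ_) o≡0) (ℤ.*-zeroʳ (facetSign ε)))

diameter-off-diagonal : ∀ {n ℓ r} (u : Vec (Vertex n) ℓ) → (∀ p q → p ≢ q → dH (lookup u p) (lookup u q) ≤ r) →
  ∀ p q → dH (lookup u p) (lookup u q) ≤ r
diameter-off-diagonal {r = r} u off p q with p ≟ᶠ q
... | yes refl = subst (_≤ r) (sym (dH-refl (lookup u p))) z≤n
... | no p≢q = off p q p≢q

module _ {n m : ℕ} {v w : Fin m → Vertex n} {x : Vertex n} where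

  cone-facet-distinct : (∀ i j → v i ≡ v j → i ≡ j) → (∀ i j → w i ≡ w j → i ≡ j) → (∀ i j → v i ≢ w j) →
    (∀ i → x ≢ v i) → (∀ i → x ≢ w i) → ∀ ε → Distinct (x ∷ facet v w ε)
  cone-facet-distinct v-injective w-injective v≢w x≢v x≢w ε = λ where
      zero zero _ → refl
      zero (suc j) e → contradiction (trans e (lookup-facet v w ε j)) (x≢pick j)
      (suc i) zero e → contradiction (trans (sym e) (lookup-facet v w ε i)) (x≢pick i)
      (suc i) (suc j) e → cong suc (pick-injective i j (trans (sym (lookup-facet v w ε i)) (trans e (lookup-facet v w ε j))))
    where
    x≢pick : ∀ i → x ≢ pick v w ε i
    x≢pick i with lookup ε i
    ... | false = x≢v i
    ... | true = x≢w i
    pick-injective : ∀ i j → pick v w ε i ≡ pick v w ε j → i ≡ j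
    pick-injective i j e with lookup ε i | lookup ε j
    ... | false | false = v-injective i j e
    ... | false | true = contradiction e (v≢w i j)
    ... | true | false = contradiction (sym e) (v≢w j i)
    ... | true | true = w-injective i j e

  cone-facet-diameter : ∀ {r} →
    (∀ i j → i ≢ j → dH (v i) (v j) ≤ r × dH (v i) (w j) ≤ r × dH (w i) (v j) ≤ r × dH (w i) (w j) ≤ r) →
    (∀ i → dH x (v i) ≤ r) → (∀ i → dH x (w i) ≤ r) →
    ∀ ε p q → dH (lookup (x ∷ facet v w ε) p) (lookup (x ∷ facet v w ε) q) ≤ r
  cone-facet-diameter {r} near x-v x-w ε = diameter-off-diagonal (x ∷ facet v w ε) λ where
      zero zero 0≢0 → contradiction refl 0≢0
      zero (suc q) _ → subst (λ z → dH x z ≤ r) (sym (lookup-facet v w ε q)) (x-pick q)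
      (suc p) zero _ → subst (λ z → dH z x ≤ r) (sym (lookup-facet v w ε p)) (subst (_≤ r) (dH-sym x _) (x-pick p))
      (suc p) (suc q) p≢q → subst₂ (λ a b → dH a b ≤ r) (sym (lookup-facet v w ε p)) (sym (lookup-facet v w ε q))
                              (pick-near p q (p≢q ∘ cong suc))
    where
    x-pick : ∀ i → dH x (pick v w ε i) ≤ r
    x-pick i with lookup ε i
    ... | false = x-v i
    ... | true = x-w i
    pick-near : ∀ i j → i ≢ j → dH (pick v w ε i) (pick v w ε j) ≤ r
    pick-near i j i≢j with lookup ε i | lookup ε j | near i j i≢j
    ... | false | false | vv , _ , _ , _ = vv
    ... | false | true | _ , vw , _ , _ = vw
    ... | true | false | _ , _ , wv , _ = wv
    ... | true | true | _ , _ , _ , ww = ww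

adjacent? : ∀ {n} r (x y : Vertex n) → Dec (AdjGc r x y)
adjacent? r x y = ¬? (x ≟ᵛ y) ×-dec (r <? dH x y)

non-adjacent-to-far-pair : ∀ {n r} {x a b : Vertex n} → ¬ AdjGc r x a → ¬ AdjGc r x b → a ≢ b → r < dH a b →
  x ≢ a × dH x a ≤ r
non-adjacent-to-far-pair {x = x} {a} ¬x~a ¬x~b a≢b far = x≢a , ≮⇒≥ λ r<d → ¬x~a (x≢a , r<d)
  where
  x≢a : x ≢ a
  x≢a refl = ¬x~b (a≢b , far)

mainTheorem4 : (n r m : ℕ) → 1 ≤ n → 1 ≤ m →
    (v w : Fin m → Vertex n) →
    (∀ i j → v i ≡ v j → i ≡ j) → (∀ i j → w i ≡ w j → i ≡ j) → (∀ i j → v i ≢ w j) →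
    (∀ i → r < dH (v i) (w i)) →
    (∀ i j → i ≢ j → dH (v i) (v j) ≤ r × dH (v i) (w j) ≤ r × dH (w i) (v j) ≤ r × dH (w i) (w j) ≤ r) →
    ¬ (∃ λ (c : Chain n (suc m)) → IsVRChain r c × (∀ τ → ∂ c τ ≡ crossCycle v w τ)) →
    TotalDominatingGc n r (λ s → ∃ λ i → s ≡ v i ⊎ s ≡ w i)
mainTheorem4 n r (suc m) _ (s≤s _) v w v-injective w-injective v≢w far near unfillable x
  with any? (λ i → adjacent? r x (v i) ⊎-dec adjacent? r x (w i))
... | yes (i , inj₁ x~v) = v i , (i , inj₁ refl) , x~v
... | yes (i , inj₂ x~w) = w i , (i , inj₂ refl) , x~w
... | no isolated =
  contradiction (coneCross x v w , coneCross-VR x v w distinct diameter , ∂-coneCross x v w distinct) unfillable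
  where
  near-v : ∀ i → x ≢ v i × dH x (v i) ≤ r
  near-v i = non-adjacent-to-far-pair (λ x~v → isolated (i , inj₁ x~v)) (λ x~w → isolated (i , inj₂ x~w))
    (v≢w i i) (far i)
  near-w : ∀ i → x ≢ w i × dH x (w i) ≤ r
  near-w i = non-adjacent-to-far-pair (λ x~w → isolated (i , inj₂ x~w)) (λ x~v → isolated (i , inj₁ x~v))
    (v≢w i i ∘ sym) (subst (r <_) (dH-sym (v i) (w i)) (far i))
  distinct : ∀ ε → Distinct (x ∷ facet v w ε)
  distinct = cone-facet-distinct v-injective w-injective v≢w (proj₁ ∘ near-v) (proj₁ ∘ near-w)
  diameter : ∀ ε p q → dH (lookup (x ∷ facet v w ε) p) (lookup (x ∷ facet v w ε) q) ≤ r
  diameter = cone-facet-diameter near (proj₂ ∘ near-v) (proj₂ ∘ near-w)
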